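{- There is a node $\ell$ in $\mathsf{eertree}(S[i-1.. j-1])$ to be removed when the leftmost character $S[i-1]$ is deleted from $S[i-1.. j-1]$ (i.e., when passing to $\mathsf{eertree}(S[i.. j-1])$) if and only if (A) $\mathit{pal}(\ell)$ is unique in $S[i-1.. j-1]$, (B) $\mathit{pal}(\ell) = \mathit{lpp}(S[i-1.. j-1])$, and (C) $\ell$ is a leaf node.
   Context: $S$ is a string over an alphabet $\Sigma$. The eertree $\mathsf{eertree}(T)$ of a string $T$ has one ordinary node for each distinct non-empty palindromic substring of $T$, plus two auxiliary nodes ($\mathtt{0}$-node and $\mathtt{ -1}$-node, both representing $\varepsilon$, with lengths $0$ and $-1$). For a node $v$, $\mathit{pal}(v)$ denotes the palindrome represented by $v$. There is an edge $(u,v)$, labeled $\mathit{pal}(v)[0]$, iff $|\mathit{pal}(v)| = |\mathit{pal}(u)|+2$ and $\mathit{pal}(u) = \mathit{pal}(v)[1..|\mathit{pal}(v)|-2]$. A string is unique in $T$ if it occurs in $T$ exactly once. $\mathit{lpp}(T)$ denotes the longest palindromic prefix of $T$. -}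

module Defs where

open import Data.Nat using (ℕ; suc; _∸_)
open import Data.Integer using (ℤ; +_; -[1+_]; _+_)
open import Data.List using (List; []; _∷_; _++_; length; take; drop; reverse)
open import Data.Product using (Σ; _×_; ∃)
open import Relation.Binary.PropositionalEquality using (_≡_; _≢_)
open import Relation.Nullary using (¬_)

module _ {A : Set} where

  -- S[a..b] (0-based, inclusive); empty when b < a
  sub : List A → ℕ → ℕ → List A
  sub S a b = take (suc b ∸ a) (drop a S)

  IsPalindrome : List A → Set
  IsPalindrome w = reverse w ≡ w

  -- an occurrence of w in T, identified by its left context u (start position = length u)
  Occurrence : List A → List A → Set
  Occurrence w T = Σ (List A) λ u → Σ (List A) λ v → u ++ (w ++ v) ≡ T

  occStart : ∀ {w T} → Occurrence w T → ℕ
  occStart (u Data.Product., _) = length u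

  Unique : List A → List A → Set
  Unique w T = Σ (Occurrence w T) λ o → ∀ (o' : Occurrence w T) → occStart o' ≡ occStart o

  IsPrefix : List A → List A → Set
  IsPrefix w T = Σ (List A) λ v → w ++ v ≡ T

  IsLpp : List A → List A → Set
  IsLpp T w = IsPrefix w T × IsPalindrome w ×
              (∀ w' → IsPrefix w' T → IsPalindrome w' → length w' Data.Nat.≤ length w)

  -- nodes of eertree(T): one ordinary node per distinct non-empty palindromic substring,
  -- plus the auxiliary 0-node and -1-node
  data Node (T : List A) : Set where
    node0  : Node T
    node-1 : Node T
    ord    : (w : List A) → w ≢ [] → IsPalindrome w → Occurrence w T → Node T

  pal : ∀ {T} → Node T → List A
  pal node0 = []
  pal node-1 = []
  pal (ord w _ _ _) = w

  len : ∀ {T} → Node T → ℤ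
  len node0 = + 0
  len node-1 = -[1+ 0 ]
  len (ord w _ _ _) = + (length w)

  middle : List A → List A
  middle w = take (length w ∸ 2) (drop 1 w)

  Edge : ∀ {T} → Node T → Node T → Set
  Edge u v = len v ≡ len u + + 2 × pal u ≡ middle (pal v)

  IsLeaf : ∀ {T} → Node T → Set
  IsLeaf {T} ℓ = ∀ (v : Node T) → ¬ Edge ℓ v

  -- node ℓ of eertree(T) is removed when passing to eertree(U):
  -- no node of eertree(U) represents the same palindrome (with the same length)
  Removed : ∀ {T} (U : List A) → Node T → Set
  Removed U ℓ = ¬ (Σ (Node U) λ m → len m ≡ len ℓ × pal m ≡ pal ℓ)

module Submission where

-- Deleting the leftmost character x from a window T = x ∷ U removes the
-- eertree node of a palindrome w exactly when w does not occur in U, i.e.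
-- exactly when every occurrence of w in T starts at position 0 (OnlyAtStart).
--
-- Two sources of occurrences of w at a positive
-- offset follow: a longer palindromic prefix of T extending w also has w as
-- a suffix, and a child a w b of w in the eertree contains w at offset 1.
-- Hence a palindrome occurring only at position 0 is unique, is the lpp of
-- T, and is a leaf.  Conversely a unique prefix of T cannot occur in U, as
-- that occurrence reappears in T at offset 1; so the backward direction
-- needs only (A) and the prefix part of (B).  The auxiliary nodes are never
-- removed and ε is never unique.

open import Defs
open import Data.Nat using (ℕ; zero; suc; _+_; _≤_; _<_; _∸_; s≤s)
open import Data.Nat.Properties using (0≢1+n; ≤-total; ≤-reflexive; +-identityʳ; m+n≡0⇒n≡0)
open import Data.List using (List; []; _∷_; _++_; [_]; length; reverse; drop)
open import Data.List.Properties using (++-assoc; length-++; length-reverse; reverse-++; take++drop≡id;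
                                     ++-identityʳ; ∷-injectiveˡ; ∷-injectiveʳ)
open import Data.Product using (Σ; _×_; _,_; proj₁; proj₂)
open import Data.Sum using (inj₁; inj₂)
open import Data.Empty using (⊥-elim)
open import Function.Bundles using (_⇔_; mk⇔; Equivalence)
open import Relation.Binary.PropositionalEquality using (_≡_; _≢_; refl; sym; trans; cong)
open import Relation.Nullary using (¬_)

module _ {A : Set} where

  OnlyAtStart : List A → List A → Set
  OnlyAtStart w T = ∀ (o : Occurrence w T) → length (proj₁ o) ≡ 0

  compose : ∀ {w v T : List A} → Occurrence w v → Occurrence v T → Occurrence w T
  compose {w} {v} {T} (u , s , eq) (u′ , s′ , eq′) = u′ ++ u , s ++ s′ , placed
    where
    open Relation.Binary.PropositionalEquality.≡-Reasoning
    placed : (u′ ++ u) ++ (w ++ (s ++ s′)) ≡ T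
    placed = begin
      (u′ ++ u) ++ (w ++ (s ++ s′)) ≡⟨ ++-assoc u′ u _ ⟩
      u′ ++ (u ++ (w ++ (s ++ s′))) ≡⟨ cong (λ z → u′ ++ (u ++ z)) (++-assoc w s s′) ⟨
      u′ ++ (u ++ ((w ++ s) ++ s′)) ≡⟨ cong (u′ ++_) (++-assoc u (w ++ s) s′) ⟨
      u′ ++ ((u ++ (w ++ s)) ++ s′) ≡⟨ cong (λ z → u′ ++ (z ++ s′)) eq ⟩
      u′ ++ (v ++ s′)               ≡⟨ eq′ ⟩
      T                             ∎

  compose-start : ∀ {w v T : List A} (o : Occurrence w v) (o′ : Occurrence v T) →
                  length (proj₁ (compose o o′)) ≡ length (proj₁ o′) + length (proj₁ o)
  compose-start (u , _) (u′ , _) = length-++ u′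

  shift : ∀ {w U : List A} (x : A) → Occurrence w U → Occurrence w (x ∷ U)
  shift x (u , s , eq) = x ∷ u , s , cong (x ∷_) eq

  prefix-occurrence : ∀ {w T : List A} → IsPrefix w T → Occurrence w T
  prefix-occurrence (s , eq) = [] , s , eq

  start-prefix : ∀ {w T : List A} (o : Occurrence w T) → length (proj₁ o) ≡ 0 → IsPrefix w T
  start-prefix ([] , s , eq) _ = s , eq

  prefix-of-prefix : (w w′ s s′ : List A) → w ++ s ≡ w′ ++ s′ → length w ≤ length w′ →
                     IsPrefix w w′
  prefix-of-prefix []      w′       s s′ eq le       = w′ , refl
  prefix-of-prefix (a ∷ w) (b ∷ w′) s s′ eq (s≤s le) with refl ← ∷-injectiveˡ eq
    with r , eq″ ← prefix-of-prefix w w′ s s′ (∷-injectiveʳ eq) le = r , cong (a ∷_) eq″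

  palindromic-border : ∀ {w w′ : List A} r → IsPalindrome w → IsPalindrome w′ → w ++ r ≡ w′ →
                       Σ (Occurrence w w′) λ o → length (proj₁ o) ≡ length r
  palindromic-border {w} {w′} r pw pw′ eq = (reverse r , [] , suffix) , length-reverse r
    where
    open Relation.Binary.PropositionalEquality.≡-Reasoning
    suffix : reverse r ++ (w ++ []) ≡ w′
    suffix = begin
      reverse r ++ (w ++ [])   ≡⟨ cong (reverse r ++_) (++-identityʳ w) ⟩
      reverse r ++ w           ≡⟨ cong (reverse r ++_) pw ⟨
      reverse r ++ reverse w   ≡⟨ reverse-++ w r ⟨
      reverse (w ++ r)         ≡⟨ cong reverse eq ⟩
      reverse w′               ≡⟨ pw′ ⟩
      w′                       ∎

  middle-occurrence : (a : A) (rest : List A) →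
                      Σ (Occurrence (middle (a ∷ rest)) (a ∷ rest)) λ o →
                        length (proj₁ o) ≡ 1
  middle-occurrence a rest =
    ([ a ] , drop k rest , cong (a ∷_) (take++drop≡id k rest)) , refl
    where k = length rest ∸ 1

  inner-offset-zero : ∀ {w v T : List A} → OnlyAtStart w T →
                      (o : Occurrence w v) (o′ : Occurrence v T) → length (proj₁ o) ≡ 0
  inner-offset-zero only o o′ =
    m+n≡0⇒n≡0 (length (proj₁ o′)) (trans (sym (compose-start o o′)) (only (compose o o′)))

  -- A palindromic prefix occurring only at position 0 is the lpp: a longer
  -- palindromic prefix would contain it again as a suffix.
  lpp-of-onlyAtStart : ∀ {w T : List A} → OnlyAtStart w T → IsPrefix w T → IsPalindrome w →
                       IsLpp T w
  lpp-of-onlyAtStart {w} {T} only (s , eq) pw = (s , eq) , pw , longest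
    where
    longest : ∀ w′ → IsPrefix w′ T → IsPalindrome w′ → length w′ ≤ length w
    longest w′ (s′ , eq′) pw′ with ≤-total (length w′) (length w)
    ... | inj₁ shorter = shorter
    ... | inj₂ longer  = ≤-reflexive same-length
      where
      extension : IsPrefix w w′
      extension = prefix-of-prefix w w′ s s′ (trans eq (sym eq′)) longer
      r : List A
      r = proj₁ extension
      border : Σ (Occurrence w w′) λ o → length (proj₁ o) ≡ length r
      border = palindromic-border r pw pw′ (proj₂ extension)
      -- r is the offset of a second occurrence of w in T, hence 0
      r-empty : length r ≡ 0
      r-empty = trans (sym (proj₂ border))
                  (inner-offset-zero only (proj₁ border) (prefix-occurrence (s′ , eq′)))
      same-length : length w′ ≡ length w
      same-length = trans (cong length (sym (proj₂ extension)))
                      (trans (length-++ w) (trans (cong (length w +_) r-empty) (+-identityʳ _)))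

  -- A palindrome occurring only at position 0 is a leaf: a child a w b
  -- would contain w at offset 1.
  leaf-of-onlyAtStart : ∀ {T : List A} w (ne : w ≢ []) (pw : IsPalindrome w)
                        (o : Occurrence w T) → OnlyAtStart w T → IsLeaf (ord w ne pw o)
  leaf-of-onlyAtStart w ne pw o only node0          (_ , w≡ε) = ne w≡ε
  leaf-of-onlyAtStart w ne pw o only node-1         (_ , w≡ε) = ne w≡ε
  leaf-of-onlyAtStart w ne pw o only (ord [] _ _ _) (_ , w≡ε) = ne w≡ε
  leaf-of-onlyAtStart w ne pw o only (ord (a ∷ rest) _ _ o′) (_ , refl) =
    0≢1+n (sym (inner-offset-zero only (proj₁ (middle-occurrence a rest)) o′))

  onlyAtStart-unique : ∀ {w T : List A} → Occurrence w T → OnlyAtStart w T → Unique w T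
  onlyAtStart-unique o only = o , λ o′ → trans (only o′) (sym (only o))

  absent-onlyAtStart : ∀ {w U : List A} (x : A) → ¬ Occurrence w U → OnlyAtStart w (x ∷ U)
  absent-onlyAtStart x absent ([] , _)          = refl
  absent-onlyAtStart x absent (y ∷ u , s , eq) = ⊥-elim (absent (u , s , ∷-injectiveʳ eq))

  -- A unique prefix of x ∷ U does not occur in U: shifted, that occurrence
  -- would be a second one in x ∷ U.
  unique-prefix-absent : ∀ {w U : List A} (x : A) → Unique w (x ∷ U) → IsPrefix w (x ∷ U) →
                         ¬ Occurrence w U
  unique-prefix-absent x (_ , same) pre oU =
    0≢1+n (trans (same (prefix-occurrence pre)) (sym (same (shift x oU))))

  empty-not-unique : (x : A) (U : List A) → ¬ Unique [] (x ∷ U)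
  empty-not-unique x U uniq = unique-prefix-absent x uniq (x ∷ U , refl) ([] , U , refl)

  removed-ord : ∀ {T : List A} (U : List A) w (ne : w ≢ []) (pw : IsPalindrome w)
                (o : Occurrence w T) → Removed U (ord w ne pw o) ⇔ (¬ Occurrence w U)
  removed-ord U w ne pw o =
    mk⇔ (λ removed oU → removed (ord w ne pw oU , refl , refl)) survivor-absent
    where
    survivor-absent : ¬ Occurrence w U → Removed U (ord w ne pw o)
    survivor-absent absent (node0 , _ , ε≡w)         = ne (sym ε≡w)
    survivor-absent absent (node-1 , _ , ε≡w)        = ne (sym ε≡w)
    survivor-absent absent (ord _ _ _ oU , _ , refl) = absent oU

  removal-criterion : (x : A) (U : List A) (ℓ : Node (x ∷ U)) →
                      Removed U ℓ ⇔ (Unique (pal ℓ) (x ∷ U) × IsLpp (x ∷ U) (pal ℓ) × IsLeaf ℓ)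
  removal-criterion x U node0  =
    mk⇔ (λ removed → ⊥-elim (removed (node0 , refl , refl)))
        (λ (uniq , _) → ⊥-elim (empty-not-unique x U uniq))
  removal-criterion x U node-1 =
    mk⇔ (λ removed → ⊥-elim (removed (node-1 , refl , refl)))
        (λ (uniq , _) → ⊥-elim (empty-not-unique x U uniq))
  removal-criterion x U (ord w ne pw o) = mk⇔ conditions removed
    where
    conditions : Removed U (ord w ne pw o) →
                 Unique w (x ∷ U) × IsLpp (x ∷ U) w × IsLeaf (ord w ne pw o)
    conditions rem = onlyAtStart-unique o only
                   , lpp-of-onlyAtStart only (start-prefix o (only o)) pw
                   , leaf-of-onlyAtStart w ne pw o only
      where
      only : OnlyAtStart w (x ∷ U)
      only = absent-onlyAtStart x (Equivalence.to (removed-ord U w ne pw o) rem)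
    removed : Unique w (x ∷ U) × IsLpp (x ∷ U) w × IsLeaf (ord w ne pw o) →
              Removed U (ord w ne pw o)
    removed (uniq , (pre , _) , _) =
      Equivalence.from (removed-ord U w ne pw o) (unique-prefix-absent x uniq pre)

  window-cons : (S : List A) (i j : ℕ) → i ≤ j → j < length S →
                Σ A λ y → sub S i j ≡ y ∷ sub S (suc i) j
  window-cons (y ∷ S) zero    j       _        _         = y , refl
  window-cons (y ∷ S) (suc i) (suc j) (s≤s i≤j) (s≤s j<n) = window-cons S i j i≤j j<n

  removal-criterion-at : ∀ {T U : List A} (x : A) → T ≡ x ∷ U → (ℓ : Node T) →
                         Removed U ℓ ⇔ (Unique (pal ℓ) T × IsLpp T (pal ℓ) × IsLeaf ℓ)
  removal-criterion-at x refl = removal-criterion x _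

lemma1 : {A : Set} (S : List A) (i j : ℕ) → 1 ≤ i → i ≤ j → j ≤ length S →
    (ℓ : Node (sub S (i ∸ 1) (j ∸ 1))) →
    Removed (sub S i (j ∸ 1)) ℓ
    ⇔ (Unique (pal ℓ) (sub S (i ∸ 1) (j ∸ 1))
    × IsLpp (sub S (i ∸ 1) (j ∸ 1)) (pal ℓ)
    × IsLeaf ℓ)
lemma1 S (suc i) (suc j) _ (s≤s i≤j) j<n with y , first ← window-cons S i j i≤j j<n =
  removal-criterion-at y first
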